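{- Let $\Gamma$ be the semigroup associated to an irreducible plane curve singularity, minimally generated by $r_0<r_1<\cdots<r_h$ with $h\ge 2$, let $d_h=\gcd(r_0,\ldots,r_{h-1})$ and $c=\mathrm c(\Gamma)$. Then $$\frac53 2^{2h-1}-\frac13\le r_h\le \frac{c}{d_h-1}-\left(\frac53 2^{2h-2}-3\cdot 2^{h-1}+\frac43\right)\frac{d_h}{d_h-1}+1\le c-\frac53 2^{2h-2}+3\cdot 2^{h-1}-\frac13.$$
   Context: A numerical semigroup is a submonoid $\Gamma$ of $(\mathbb N,+)$ with finite complement in $\mathbb N$; $\mathrm F(\Gamma)$ is the largest integer not in $\Gamma$ and $\mathrm c(\Gamma)=\mathrm F(\Gamma)+1$. $\langle X\rangle$ denotes the submonoid of $\mathbb N$ generated by $X$. For minimal generators listed in a fixed order $(r_0,\ldots,r_h)$, set $d_k=\gcd(r_0,\ldots,r_{k-1})$ for $k=1,\ldots,h+1$, $e_k=d_k/d_{k+1}$ for $k=1,\ldots,h$, and $\Gamma_k=\langle r_0/d_{k+1},\ldots,r_k/d_{k+1}\rangle$. Gluing: if $A$ is the minimal generating set of a numerical semigroup and $A=A_1\cup A_2$ is a nontrivial partition with $a_i=\gcd(A_i)$, then $A$ is the gluing of $A_1$ and $A_2$ if $\mathrm{lcm}(a_1,a_2)\in\langle A_1\rangle\cap\langle A_2\rangle$. $\Gamma$ is free for the arrangement $(r_0,\ldots,r_h)$ if either $h=0$ (so $r_0=1$) or $\{r_0,\ldots,r_h\}$ is the gluing of $\{r_0,\ldots,r_{h-1}\}$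 and $\{r_h\}$ and $\Gamma_{h-1}$ is free for the arrangement $(r_0/d_h,\ldots,r_{h-1}/d_h)$. $\Gamma$ is telescopic if it is free for the increasing arrangement $r_0<\cdots<r_h$. $\Gamma$ is the semigroup associated to an irreducible plane curve singularity if it is telescopic and $e_kr_k<r_{k+1}$ for all $k=1,\ldots,h-1$. -}

module Defs where

open import Data.Nat using (ℕ; zero; suc; _+_; _*_; _∸_; _≤_; _<_; _/_)
open import Data.Nat.GCD using (gcd)
open import Data.Nat.LCM using (lcm)
open import Data.Fin as Fin using (Fin; zero; suc; inject₁; fromℕ; punchIn)
open import Data.Product using (Σ; ∃; _×_)
open import Relation.Nullary using (¬_)
open import Relation.Binary.PropositionalEquality using (_≡_)

finSum : ∀ {n} → (Fin n → ℕ) → ℕ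
finSum {zero}  f = 0
finSum {suc n} f = f zero + finSum (λ i → f (suc i))

InSG : ∀ {n} → (Fin n → ℕ) → ℕ → Set
InSG {n} r m = Σ (Fin n → ℕ) λ λs → finSum (λ i → λs i * r i) ≡ m

IsNumericalSemigroup : ∀ {n} → (Fin n → ℕ) → Set
IsNumericalSemigroup r = ∃ λ N → ∀ m → N ≤ m → InSG r m

IsMinimal : ∀ {n} → (Fin (suc n) → ℕ) → Set
IsMinimal r = ∀ i → ¬ InSG (λ j → r (punchIn i j)) (r i)

IsMinGenNumSG : ∀ {n} → (Fin (suc n) → ℕ) → Set
IsMinGenNumSG r = IsNumericalSemigroup r × IsMinimal r

StrictlyIncreasing : ∀ {n} → (Fin n → ℕ) → Set
StrictlyIncreasing r = ∀ i j → i Fin.< j → r i < r j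

IsConductor : ∀ {n} → (Fin n → ℕ) → ℕ → Set
IsConductor r c =
  (∀ m → c ≤ m → InSG r m) × (∀ c' → (∀ m → c' ≤ m → InSG r m) → c ≤ c')

-- the sequence r_0, r_1, … extended by 0 beyond the last index
ext : ∀ {n} → (Fin n → ℕ) → ℕ → ℕ
ext {zero}  r k       = 0
ext {suc n} r zero    = r zero
ext {suc n} r (suc k) = ext (λ i → r (suc i)) k

-- d_k = gcd(r_0, …, r_{k-1})   (used for 1 ≤ k ≤ h+1)
d : ∀ {n} → (Fin n → ℕ) → ℕ → ℕ
d r zero    = 0
d r (suc k) = gcd (d r k) (ext r k)

-- total natural-number division (only ever used with nonzero divisor
-- d_k ≥ 1 when the r_i are minimal generators of a numerical semigroup)
_÷_ : ℕ → ℕ → ℕ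
m ÷ zero  = 0
m ÷ suc n = m / suc n

e : ∀ {n} → (Fin n → ℕ) → ℕ → ℕ
e r k = d r k ÷ d r (suc k)

-- Freeness for the arrangement (r_0, …, r_h):
--  h = 0 : r_0 = 1;
--  h ≥ 1 : {r_0,…,r_h} (minimal generating set of a numerical semigroup) is
--          the gluing of {r_0,…,r_{h-1}} and {r_h}, i.e.
--          lcm(d_h, r_h) ∈ ⟨r_0,…,r_{h-1}⟩ ∩ ⟨r_h⟩, and Γ_{h-1} is free for
--          (r_0/d_h, …, r_{h-1}/d_h).
Free : (h : ℕ) → (Fin (suc h) → ℕ) → Set
Free zero    r = r zero ≡ 1
Free (suc h) r =
  IsMinGenNumSG r
  × InSG (λ i → r (inject₁ i)) (lcm (d r (suc h)) (r (fromℕ (suc h))))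
  × InSG {1} (λ _ → r (fromℕ (suc h))) (lcm (d r (suc h)) (r (fromℕ (suc h))))
  × Free h (λ i → r (inject₁ i) ÷ d r (suc h))

Telescopic : (h : ℕ) → (Fin (suc h) → ℕ) → Set
Telescopic h r = StrictlyIncreasing r × Free h r

PlaneCurveSemigroup : (h : ℕ) → (Fin (suc h) → ℕ) → Set
PlaneCurveSemigroup h r =
  Telescopic h r × (∀ k → 1 ≤ k → k ≤ h ∸ 1 → e r k * ext r k < ext r (suc k))

module Submission where

-- A free semigroup is a gluing Γ = d_h Γ_{h-1} + r_h ℕ with gcd(d_h, r_h) = 1 and
-- r_h ∈ Γ_{h-1}. If g is a gap of Γ_{h-1} then d_h g + (d_h - 1) r_h is a gap of Γ: in a
-- representation of it the coefficient l of r_h satisfies d_h ∣ l + 1, and removing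
-- (l + 1) r_h would put g into Γ_{h-1}. Hence c(Γ) ≥ d_h c(Γ_{h-1}) + (d_h - 1)(r_h - 1).
-- Along the chain of gluings every d_k ≥ 2, so the plane-curve inequality r_{k+1} > e_k r_k
-- makes the last generator of each Γ_k at least four times that of Γ_{k-1}. Inductively
-- 3 r_k + 1 ≥ 10·4^(k-1) and 3 c(Γ_k) + 9·2^k ≥ 5·4^k + 4, and the three inequalities are
-- these bounds combined, with the denominators cleared.

open import Defs
open import Data.Nat using (ℕ; zero; suc; _+_; _*_; _^_; _∸_; _≤_; _<_; z≤n; s≤s; s≤s⁻¹; z<s; _≤?_; NonZero; >-nonZero)
open import Data.Nat.Properties
open import Data.Nat.Divisibility using (_∣_; divides; ∣-trans; ∣m∣n⇒∣m+n; ∣m+n∣m⇒∣n; n∣m*n; m∣m*n; ∣1⇒≡1; 0∣⇒≡0)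
open import Data.Nat.DivMod using (_/_; m*n/n≡m; m*n/m*o≡n/o; n/1≡n)
open import Data.Nat.GCD using (gcd; gcd[m,n]∣m; gcd[m,n]∣n; c*gcd[m,n]≡gcd[cm,cn]; gcd-zeroˡ; gcd-identityˡ)
open import Data.Nat.LCM using (lcm; gcd*lcm)
open import Data.Nat.Coprimality using (gcd≡1⇒coprime; coprime-divisor)
open import Data.Nat.Tactic.RingSolver using (solve)
open import Algebra.Properties.CommutativeSemigroup +-commutativeSemigroup
  using () renaming (interchange to +-interchange)
open import Algebra.Properties.CommutativeSemigroup *-commutativeSemigroup
  using () renaming (x∙yz≈y∙xz to *-left-comm)
open import Data.Fin using (Fin; zero; suc; fromℕ; inject₁; toℕ; punchIn)
open import Data.Fin.Properties using (toℕ-inject₁; toℕ<n; toℕ-fromℕ)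
open import Data.Integer using (ℤ; +_; _⊖_) renaming (_+_ to _+ℤ_; _-_ to _-ℤ_; _*_ to _*ℤ_; _≤_ to _≤ℤ_)
import Data.Integer.Properties as ℤ
import Data.Integer.Tactic.RingSolver as ℤ
open import Data.List using (_∷_; [])
open import Data.Product using (_×_; ∃-syntax; _,_; proj₁; proj₂)
open import Data.Sum using (inj₁; inj₂)
open import Data.Empty using (⊥-elim)
open import Relation.Nullary using (¬_; yes; no)
open import Relation.Binary.PropositionalEquality

finSum-cong : ∀ {n} {f g : Fin n → ℕ} → (∀ i → f i ≡ g i) → finSum f ≡ finSum g
finSum-cong {zero}  f≗g = refl
finSum-cong {suc n} f≗g = cong₂ _+_ (f≗g zero) (finSum-cong (λ i → f≗g (suc i)))

finSum-distrib-+ : ∀ {n} (f g : Fin n → ℕ) → finSum (λ i → f i + g i) ≡ finSum f + finSum g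
finSum-distrib-+ {zero}  f g = refl
finSum-distrib-+ {suc n} f g =
  trans (cong (λ t → f zero + g zero + t) (finSum-distrib-+ (λ i → f (suc i)) (λ i → g (suc i))))
        (+-interchange (f zero) (g zero) _ _)

*-distribˡ-finSum : ∀ {n} m (f : Fin n → ℕ) → finSum (λ i → m * f i) ≡ m * finSum f
*-distribˡ-finSum {zero}  m f = sym (*-zeroʳ m)
*-distribˡ-finSum {suc n} m f =
  trans (cong (λ t → m * f zero + t) (*-distribˡ-finSum m (λ i → f (suc i))))
        (sym (*-distribˡ-+ m (f zero) _))

finSum-init-last : ∀ {n} (f : Fin (suc n) → ℕ) →
  finSum f ≡ finSum (λ i → f (inject₁ i)) + f (fromℕ n)
finSum-init-last {zero}  f = +-identityʳ (f zero)
finSum-init-last {suc n} f =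
  trans (cong (λ t → f zero + t) (finSum-init-last (λ i → f (suc i)))) (sym (+-assoc (f zero) _ _))

∣-finSum : ∀ {n m} (f : Fin n → ℕ) → (∀ i → m ∣ f i) → m ∣ finSum f
∣-finSum {zero}  f m∣f = divides 0 refl
∣-finSum {suc n} f m∣f = ∣m∣n⇒∣m+n (m∣f zero) (∣-finSum (λ i → f (suc i)) (λ i → m∣f (suc i)))

InSG-resp : ∀ {n} {s t : Fin n → ℕ} → (∀ i → s i ≡ t i) → ∀ {x} → InSG s x → InSG t x
InSG-resp s≗t (λs , eq) = λs , trans (finSum-cong (λ i → cong (λs i *_) (sym (s≗t i)))) eq

InSG-+ : ∀ {n} {s : Fin n → ℕ} {x y} → InSG s x → InSG s y → InSG s (x + y)
InSG-+ {s = s} (λs , refl) (μs , refl) = (λ i → λs i + μs i) ,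
  trans (finSum-cong (λ i → *-distribʳ-+ (s i) (λs i) (μs i)))
        (finSum-distrib-+ (λ i → λs i * s i) (λ i → μs i * s i))

InSG-* : ∀ {n} {s : Fin n → ℕ} m {x} → InSG s x → InSG s (m * x)
InSG-* {s = s} m (λs , refl) = (λ i → m * λs i) ,
  trans (finSum-cong (λ i → *-assoc m (λs i) (s i))) (*-distribˡ-finSum m (λ i → λs i * s i))

∣-InSG : ∀ {n m} {s : Fin n → ℕ} → (∀ i → m ∣ s i) → ∀ {x} → InSG s x → m ∣ x
∣-InSG m∣s (λs , refl) = ∣-finSum _ (λ i → ∣-trans (m∣s i) (n∣m*n (λs _)))

InSG-*-cancelˡ : ∀ {n} {s t : Fin n → ℕ} m .{{_ : NonZero m}} → (∀ i → t i ≡ m * s i) →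
  ∀ {x} → InSG t (m * x) → InSG s x
InSG-*-cancelˡ {s = s} {t} m t≡m*s {x} (λs , eq) = λs , *-cancelˡ-≡ _ x m (begin
  m * finSum (λ i → λs i * s i)   ≡⟨ *-distribˡ-finSum m (λ i → λs i * s i) ⟨
  finSum (λ i → m * (λs i * s i)) ≡⟨ finSum-cong (λ i → *-left-comm m (λs i) (s i)) ⟩
  finSum (λ i → λs i * (m * s i)) ≡⟨ finSum-cong (λ i → cong (λs i *_) (t≡m*s i)) ⟨
  finSum (λ i → λs i * t i)       ≡⟨ eq ⟩
  m * x                           ∎)
  where open ≡-Reasoning

InSG-glued : ∀ {n m} {u : Fin (suc n) → ℕ} {s : Fin n → ℕ} → (∀ i → u (inject₁ i) ≡ m * s i) →
  ∀ {x} → InSG u x → ∃[ y ] ∃[ l ] InSG s y × m * y + l * u (fromℕ n) ≡ x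
InSG-glued {n} {m} {u} {s} u≡m*s (λs , eq) = y , λs (fromℕ n) , ((λ i → λs (inject₁ i)) , refl) ,
  trans (cong (_+ λs (fromℕ n) * u (fromℕ n)) m*y≡init) (trans (sym (finSum-init-last (λ i → λs i * u i))) eq)
  where
  open ≡-Reasoning
  y : ℕ
  y = finSum (λ i → λs (inject₁ i) * s i)
  m*y≡init : m * y ≡ finSum (λ i → λs (inject₁ i) * u (inject₁ i))
  m*y≡init = begin
    m * y                                       ≡⟨ *-distribˡ-finSum m (λ i → λs (inject₁ i) * s i) ⟨
    finSum (λ i → m * (λs (inject₁ i) * s i))   ≡⟨ finSum-cong (λ i → *-left-comm m (λs (inject₁ i)) (s i)) ⟩
    finSum (λ i → λs (inject₁ i) * (m * s i))   ≡⟨ finSum-cong (λ i → cong (λs (inject₁ i) *_) (u≡m*s i)) ⟨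
    finSum (λ i → λs (inject₁ i) * u (inject₁ i)) ∎

numSG-divisor≡1 : ∀ {n m} {s : Fin n → ℕ} → IsNumericalSemigroup s → (∀ i → m ∣ s i) → m ≡ 1
numSG-divisor≡1 (N , ≥N⇒∈) m∣s =
  ∣1⇒≡1 (∣m+n∣m⇒∣n (∣-InSG m∣s (≥N⇒∈ (N + 1) (m≤m+n N 1))) (∣-InSG m∣s (≥N⇒∈ N ≤-refl)))

minGen≢0 : ∀ {n} {u : Fin (suc n) → ℕ} → IsMinimal u → ∀ i → u i ≢ 0
minGen≢0 {u = u} minimal i u≡0 =
  minimal i ((λ _ → 0) , trans (*-distribˡ-finSum 0 (λ j → u (punchIn i j))) (sym u≡0))

coprime⇒lcm≡* : ∀ {m n} → gcd m n ≡ 1 → lcm m n ≡ m * n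
coprime⇒lcm≡* {m} {n} gcd≡1 =
  trans (sym (*-identityˡ _)) (subst (λ g → g * lcm m n ≡ m * n) gcd≡1 (gcd*lcm m n))

ext-toℕ : ∀ {n} (r : Fin n → ℕ) i → ext r (toℕ i) ≡ r i
ext-toℕ r zero    = refl
ext-toℕ r (suc i) = ext-toℕ (λ j → r (suc j)) i

ext-fromℕ : ∀ {n} (r : Fin (suc n) → ℕ) → ext r n ≡ r (fromℕ n)
ext-fromℕ {n} r = trans (cong (ext r) (sym (toℕ-fromℕ n))) (ext-toℕ r (fromℕ n))

ext-inject₁ : ∀ {n} (r : Fin (suc n) → ℕ) {j} → j < n → ext (λ i → r (inject₁ i)) j ≡ ext r j
ext-inject₁ {suc n} r {zero}  _         = refl
ext-inject₁ {suc n} r {suc j} (s≤s j<n) = ext-inject₁ (λ i → r (suc i)) j<n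

ext-*ˡ : ∀ {n m} {r s : Fin n → ℕ} → (∀ i → r i ≡ m * s i) → ∀ j → ext r j ≡ m * ext s j
ext-*ˡ {zero}  {m} r≡m*s j       = sym (*-zeroʳ m)
ext-*ˡ {suc n}     r≡m*s zero    = r≡m*s zero
ext-*ˡ {suc n} {m} r≡m*s (suc j) = ext-*ˡ {m = m} (λ i → r≡m*s (suc i)) j

d∣ext : ∀ {n} (r : Fin n → ℕ) {j} k → j < k → d r k ∣ ext r j
d∣ext r {j} (suc k) j<1+k with m≤n⇒m<n∨m≡n (s≤s⁻¹ j<1+k)
... | inj₁ j<k  = ∣-trans (gcd[m,n]∣m (d r k) (ext r k)) (d∣ext r k j<k)
... | inj₂ refl = gcd[m,n]∣n (d r k) (ext r k)

d∣gen : ∀ {n} (r : Fin n → ℕ) {k} (i : Fin n) → toℕ i < k → d r k ∣ r i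
d∣gen r {k} i i<k = subst (d r k ∣_) (ext-toℕ r i) (d∣ext r k i<k)

d-*ˡ : ∀ {n n'} {r : Fin n → ℕ} {s : Fin n' → ℕ} {m} k →
  (∀ {j} → j < k → ext r j ≡ m * ext s j) → d r k ≡ m * d s k
d-*ˡ {m = m} zero    _         = sym (*-zeroʳ m)
d-*ˡ {r = r} {s} {m} (suc k) ext≡m*ext = begin
  gcd (d r k) (ext r k)          ≡⟨ cong₂ gcd d-r≡m*d-s (ext≡m*ext ≤-refl) ⟩
  gcd (m * d s k) (m * ext s k)  ≡⟨ c*gcd[m,n]≡gcd[cm,cn] m (d s k) (ext s k) ⟨
  m * gcd (d s k) (ext s k)      ∎
  where
  open ≡-Reasoning
  d-r≡m*d-s : d r k ≡ m * d s k
  d-r≡m*d-s = d-*ˡ {r = r} {s} {m} k (λ j<k → ext≡m*ext (m<n⇒m<1+n j<k))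

∣⇒≡*÷ : ∀ {m x} → m ∣ x → x ≡ m * (x ÷ m)
∣⇒≡*÷ {zero}  m∣x              = 0∣⇒≡0 m∣x
∣⇒≡*÷ {suc m} (divides q refl) = trans (*-comm q (suc m)) (cong (suc m *_) (sym (m*n/n≡m q (suc m))))

*-cancelˡ-÷ : ∀ m {a b} .{{_ : NonZero m}} → (m * a) ÷ (m * b) ≡ a ÷ b
*-cancelˡ-÷ m {a} {zero}  rewrite *-zeroʳ m = refl
*-cancelˡ-÷ m {a} {suc b} = trans (÷≡/ (m * a) (m * suc b) {{m*n≢0 m (suc b)}})
                                  (m*n/m*o≡n/o m a (suc b) {{_}} {{m*n≢0 m (suc b)}})
  where
  ÷≡/ : ∀ x y .{{_ : NonZero y}} → x ÷ y ≡ x / y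
  ÷≡/ x (suc y) = refl

punchIn-fromℕ : ∀ n (j : Fin n) → punchIn (fromℕ n) j ≡ inject₁ j
punchIn-fromℕ (suc n) zero    = refl
punchIn-fromℕ (suc n) (suc j) = cong suc (punchIn-fromℕ n j)

d-last≥2 : ∀ {k} {u : Fin (suc (suc k)) → ℕ} → Free (suc k) u → 2 ≤ d u (suc k)
d-last≥2 {k} {u} ((_ , minimal) , lcm∈⟨init⟩ , _) = ≤∧≢⇒< (n≢0⇒n>0 d≢0) 1≢d
  where
  D r : ℕ
  D = d u (suc k)
  r = u (fromℕ (suc k))
  d≢0 : D ≢ 0
  d≢0 D≡0 = minGen≢0 minimal zero (0∣⇒≡0 (subst (_∣ u zero) D≡0 (d∣ext u (suc k) (s≤s z≤n))))
  1≢d : 1 ≢ D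
  1≢d 1≡D = minimal (fromℕ (suc k)) (InSG-resp (λ i → cong u (sym (punchIn-fromℕ (suc k) i)))
    (subst (InSG (λ i → u (inject₁ i)))
           (trans (cong (λ m → lcm m r) (sym 1≡D)) (trans (coprime⇒lcm≡* {1} {r} (gcd-zeroˡ r)) (*-identityˡ r)))
           lcm∈⟨init⟩))

-- C ∸ 1 is a gap of ⟨s⟩; nothing is required for C = 0, which is how ⟨1⟩ (no gaps) is covered.
GapBelow : ∀ {n} → (Fin n → ℕ) → ℕ → Set
GapBelow s C = ∀ x → suc x ≡ C → ¬ InSG s x

GapBelow⇒≤conductor : ∀ {n} {s : Fin n → ℕ} {C c} → GapBelow s C → (∀ m → c ≤ m → InSG s m) → C ≤ c
GapBelow⇒≤conductor {C = zero}      gap _      = z≤n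
GapBelow⇒≤conductor {C = suc x} {c} gap ≥c⇒∈ with suc x ≤? c
... | yes x<c = x<c
... | no  x≮c = ⊥-elim (gap x refl (≥c⇒∈ x (s≤s⁻¹ (≰⇒> x≮c))))

glued-gap-arith : ∀ {D r y l C} → 0 < D → 0 < r → gcd D r ≡ 1 →
  suc (D * y + l * r) ≡ D * C + (D ∸ 1) * (r ∸ 1) → ∃[ j ] suc (y + j * r) ≡ C
glued-gap-arith {D@(suc δ)} {r@(suc ρ)} {y} {l} {C} _ _ gcd≡1 eq =
  use-quotient (coprime-divisor (gcd≡1⇒coprime gcd≡1) D∣r*[1+l])
  where
  open ≡-Reasoning
  D[C+r]≡D[1+y]+r[1+l] : D * (C + r) ≡ D * suc y + r * suc l
  D[C+r]≡D[1+y]+r[1+l] = begin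
    D * (C + r)                    ≡⟨ solve (δ ∷ ρ ∷ C ∷ []) ⟩
    (D * C + δ * ρ) + (r + δ)      ≡⟨ cong (_+ (r + δ)) eq ⟨
    suc (D * y + l * r) + (r + δ)  ≡⟨ solve (δ ∷ ρ ∷ y ∷ l ∷ []) ⟩
    D * suc y + r * suc l          ∎
  D∣r*[1+l] : D ∣ r * suc l
  D∣r*[1+l] = ∣m+n∣m⇒∣n (subst (D ∣_) D[C+r]≡D[1+y]+r[1+l] (m∣m*n (C + r))) (m∣m*n (suc y))
  use-quotient : D ∣ suc l → ∃[ j ] suc (y + j * r) ≡ C
  use-quotient (divides (suc j) 1+l≡[1+j]*D) = j , +-cancelˡ-≡ r _ C (*-cancelˡ-≡ _ _ D (begin
    D * (r + suc (y + j * r))         ≡⟨ solve (δ ∷ ρ ∷ y ∷ j ∷ []) ⟩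
    D * suc y + r * (suc j * D)       ≡⟨ cong (λ t → D * suc y + r * t) 1+l≡[1+j]*D ⟨
    D * suc y + r * suc l             ≡⟨ D[C+r]≡D[1+y]+r[1+l] ⟨
    D * (C + r)                       ≡⟨ cong (D *_) (+-comm C r) ⟩
    D * (r + C)                       ∎))

glued-gap : ∀ {n D C} {u : Fin (suc n) → ℕ} {s : Fin n → ℕ} → 0 < D →
  (∀ i → u (inject₁ i) ≡ D * s i) → 0 < u (fromℕ n) → gcd D (u (fromℕ n)) ≡ 1 →
  InSG s (u (fromℕ n)) → GapBelow s C → GapBelow u (D * C + (D ∸ 1) * (u (fromℕ n) ∸ 1))
glued-gap {D = D} {u = u} {s} D>0 u≡D*s r>0 gcd≡1 r∈ gap x 1+x≡ x∈
  with InSG-glued {m = D} {u} {s} u≡D*s x∈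
... | y , l , y∈ , refl with glued-gap-arith {y = y} {l} D>0 r>0 gcd≡1 1+x≡
...   | j , 1+y+jr≡C = gap _ 1+y+jr≡C (InSG-+ y∈ (InSG-* j r∈))

PlaneInequalities : (h : ℕ) → (Fin (suc h) → ℕ) → Set
PlaneInequalities h r = ∀ k → 1 ≤ k → k ≤ h ∸ 1 → e r k * ext r k < ext r (suc k)

≤∸1⇒< : ∀ {m n} → 0 < m → m ≤ n ∸ 1 → m < n
≤∸1⇒< {n = suc n} _       m≤n = s≤s m≤n
≤∸1⇒< {n = zero}  (s≤s _) ()

module Gluing {k} (u : Fin (suc (suc k)) → ℕ) (free : Free (suc k) u) where

  D : ℕ
  D = d u (suc k)

  D≥2 : 2 ≤ D
  D≥2 = d-last≥2 free

  instance
    D≢0 : NonZero D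
    D≢0 = >-nonZero (<-trans z<s D≥2)

  s : Fin (suc k) → ℕ
  s i = u (inject₁ i) ÷ D

  r : ℕ
  r = u (fromℕ (suc k))

  s-free : Free k s
  s-free = proj₂ (proj₂ (proj₂ free))

  u≡D*s : ∀ i → u (inject₁ i) ≡ D * s i
  u≡D*s i = ∣⇒≡*÷ (d∣gen u (inject₁ i) (subst (_< suc k) (sym (toℕ-inject₁ i)) (toℕ<n i)))

  ext-u≡D*ext-s : ∀ {j} → j < suc k → ext u j ≡ D * ext s j
  ext-u≡D*ext-s {j} j<1+k =
    trans (sym (ext-inject₁ u j<1+k)) (ext-*ˡ {m = D} {λ i → u (inject₁ i)} {s} u≡D*s j)

  d-u≡D*d-s : ∀ {j} → j ≤ suc k → d u j ≡ D * d s j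
  d-u≡D*d-s {j} j≤1+k = d-*ˡ {r = u} {s} {D} j (λ i<j → ext-u≡D*ext-s (<-≤-trans i<j j≤1+k))

  d-s≡1 : d s (suc k) ≡ 1
  d-s≡1 = *-cancelˡ-≡ _ _ D (trans (sym (d-u≡D*d-s ≤-refl)) (sym (*-identityʳ D)))

  gcd[D,r]≡1 : gcd D r ≡ 1
  gcd[D,r]≡1 = trans (cong (gcd D) (sym (ext-fromℕ u)))
                     (numSG-divisor≡1 (proj₁ (proj₁ free)) (λ i → d∣gen u i (toℕ<n i)))

  r>0 : 0 < r
  r>0 = n≢0⇒n>0 (minGen≢0 {u = u} (proj₂ (proj₁ free)) (fromℕ (suc k)))

  r∈⟨s⟩ : InSG s r
  r∈⟨s⟩ = InSG-*-cancelˡ D u≡D*s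
    (subst (InSG (λ i → u (inject₁ i))) (coprime⇒lcm≡* {D} {r} gcd[D,r]≡1) (proj₁ (proj₂ free)))

  gap-glued : ∀ {C} → GapBelow s C → GapBelow u (D * C + (D ∸ 1) * (r ∸ 1))
  gap-glued = glued-gap {u = u} {s} (<-trans z<s D≥2) u≡D*s r>0 gcd[D,r]≡1 r∈⟨s⟩

  e-u≡e-s : ∀ {j} → j ≤ k → e u j ≡ e s j
  e-u≡e-s j≤k = trans (cong₂ _÷_ (d-u≡D*d-s (m≤n⇒m≤1+n j≤k)) (d-u≡D*d-s (s≤s j≤k))) (*-cancelˡ-÷ D)

  s-increasing : StrictlyIncreasing u → StrictlyIncreasing s
  s-increasing u↑ i j i<j = *-cancelˡ-< D (s i) (s j) (subst₂ _<_ (u≡D*s i) (u≡D*s j)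
    (u↑ (inject₁ i) (inject₁ j) (subst₂ _<_ (sym (toℕ-inject₁ i)) (sym (toℕ-inject₁ j)) i<j)))

  s-plane : PlaneInequalities (suc k) u → PlaneInequalities k s
  s-plane plane j 1≤j j≤k∸1 = *-cancelˡ-< D _ _ (subst₂ _<_ D*[e*ext] (ext-u≡D*ext-s (s≤s j<k))
    (plane j 1≤j (≤-trans j≤k∸1 (m∸n≤m k 1))))
    where
    j<k : j < k
    j<k = ≤∸1⇒< 1≤j j≤k∸1
    D*[e*ext] : e u j * ext u j ≡ D * (e s j * ext s j)
    D*[e*ext] = trans (cong₂ _*_ (e-u≡e-s (<⇒≤ j<k)) (ext-u≡D*ext-s (m<n⇒m<1+n j<k)))
                      (*-left-comm (e s j) D (ext s j))

last-bound-step : ∀ P {x y} → 10 * (P * P) ≤ 3 * x + 1 → 4 * x < y →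
  10 * ((2 * P) * (2 * P)) ≤ 3 * y + 1
last-bound-step P {x} {y} bound 4x<y = begin
  10 * ((2 * P) * (2 * P)) ≡⟨ solve (P ∷ []) ⟩
  4 * (10 * (P * P))       ≤⟨ *-monoʳ-≤ 4 bound ⟩
  4 * (3 * x + 1)          ≡⟨ solve (x ∷ []) ⟩
  3 * suc (4 * x) + 1      ≤⟨ +-monoˡ-≤ 1 (*-monoʳ-≤ 3 4x<y) ⟩
  3 * y + 1                ∎
  where open ≤-Reasoning

last-growth : ∀ {k} (u : Fin (suc (suc (suc k))) → ℕ) (free : Free (suc (suc k)) u) →
  PlaneInequalities (suc (suc k)) u → 4 * Gluing.s u free (fromℕ (suc k)) < u (fromℕ (suc (suc k)))
last-growth {k} u free plane = begin-strict
  4 * s (fromℕ (suc k))                       ≡⟨ *-assoc 2 2 (s (fromℕ (suc k))) ⟩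
  2 * (2 * s (fromℕ (suc k)))                 ≤⟨ *-mono-≤ (d-last≥2 s-free) (*-monoˡ-≤ (s (fromℕ (suc k))) D≥2) ⟩
  d s (suc k) * (D * s (fromℕ (suc k)))       ≡⟨ cong₂ _*_ e-u≡d-s ext-u≡D*s-last ⟨
  e u (suc k) * ext u (suc k)                 <⟨ plane (suc k) (s≤s z≤n) ≤-refl ⟩
  ext u (suc (suc k))                         ≡⟨ ext-fromℕ u ⟩
  u (fromℕ (suc (suc k)))                     ∎
  where
  open Gluing u free
  open ≤-Reasoning
  ext-u≡D*s-last : ext u (suc k) ≡ D * s (fromℕ (suc k))
  ext-u≡D*s-last = trans (ext-u≡D*ext-s ≤-refl) (cong (D *_) (ext-fromℕ s))
  e-u≡d-s : e u (suc k) ≡ d s (suc k)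
  e-u≡d-s = trans (e-u≡e-s ≤-refl) (trans (cong (d s (suc k) ÷_) d-s≡1) (n/1≡n (d s (suc k))))

last-lower-bound : ∀ k (u : Fin (suc (suc k)) → ℕ) → Free (suc k) u → StrictlyIncreasing u →
  PlaneInequalities (suc k) u → 10 * (2 ^ k * 2 ^ k) ≤ 3 * u (fromℕ (suc k)) + 1
last-lower-bound zero    u free u↑ _ = +-monoˡ-≤ 1 (*-monoʳ-≤ 3 2<u₁)
  where
  2<u₁ : 2 < u (suc zero)
  2<u₁ = ≤-<-trans (subst (2 ≤_) (gcd-identityˡ (u zero)) (d-last≥2 free)) (u↑ zero (suc zero) z<s)
last-lower-bound (suc k) u free u↑ plane = last-bound-step (2 ^ k) {s (fromℕ (suc k))}
  (last-lower-bound k s s-free (s-increasing u↑) (s-plane plane)) (last-growth u free plane)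
  where open Gluing u free

conductor-bound-step : ∀ {P C D r} → 2 ≤ D → 0 < r →
  5 * (P * P) + 4 ≤ 3 * C + 9 * P → 10 * (P * P) ≤ 3 * r + 1 →
  5 * ((2 * P) * (2 * P)) + 4 ≤ 3 * (D * C + (D ∸ 1) * (r ∸ 1)) + 9 * (2 * P)
conductor-bound-step {P} {C} {D} {r@(suc ρ)} D≥2 _ C-bound r-bound = +-cancelʳ-≤ 4 _ _ (begin
  5 * ((2 * P) * (2 * P)) + 4 + 4               ≡⟨ solve (P ∷ []) ⟩
  2 * (5 * (P * P) + 4) + 10 * (P * P)          ≤⟨ +-mono-≤ (*-monoʳ-≤ 2 C-bound) r-bound ⟩
  2 * (3 * C + 9 * P) + (3 * r + 1)             ≡⟨ solve (P ∷ C ∷ ρ ∷ []) ⟩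
  3 * (2 * C + 1 * ρ) + 9 * (2 * P) + 4         ≤⟨ +-monoˡ-≤ 4 (+-monoˡ-≤ (9 * (2 * P)) (*-monoʳ-≤ 3 glued≥)) ⟩
  3 * (D * C + (D ∸ 1) * ρ) + 9 * (2 * P) + 4   ∎)
  where
  open ≤-Reasoning
  glued≥ : 2 * C + 1 * ρ ≤ D * C + (D ∸ 1) * ρ
  glued≥ = +-mono-≤ (*-monoˡ-≤ C D≥2) (*-monoˡ-≤ ρ (∸-monoˡ-≤ 1 D≥2))

conductor-lower-bound : ∀ k (u : Fin (suc k) → ℕ) → Free k u → StrictlyIncreasing u →
  PlaneInequalities k u → ∃[ C ] GapBelow u C × 5 * (2 ^ k * 2 ^ k) + 4 ≤ 3 * C + 9 * 2 ^ k
conductor-lower-bound zero    u _    _  _     = 0 , (λ _ ()) , ≤-refl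
conductor-lower-bound (suc k) u free u↑ plane =
  let C , gap , C-bound = conductor-lower-bound k s s-free (s-increasing u↑) (s-plane plane)
  in  D * C + (D ∸ 1) * (r ∸ 1) , gap-glued gap ,
      conductor-bound-step {2 ^ k} {C} {D} {r} D≥2 r>0 C-bound (last-lower-bound k u free u↑ plane)
  where open Gluing u free

⊖-mono-≤ : ∀ {a b c e} → a + e ≤ c + b → a ⊖ b ≤ℤ c ⊖ e
⊖-mono-≤ {a} {b} {c} {e} a+e≤c+b = begin
  a ⊖ b             ≡⟨ ℤ.+-cancelˡ-⊖ e a b ⟨
  (e + a) ⊖ (e + b) ≤⟨ ℤ.⊖-monoˡ-≤ (e + b) (subst₂ _≤_ (+-comm a e) (+-comm c b) a+e≤c+b) ⟩
  (b + c) ⊖ (e + b) ≡⟨ cong ((b + c) ⊖_) (+-comm e b) ⟩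
  (b + c) ⊖ (b + e) ≡⟨ ℤ.+-cancelˡ-⊖ b c e ⟩
  c ⊖ e             ∎
  where open ℤ.≤-Reasoning

affine-⊖ : ∀ a b c e f g →
  + a -ℤ (+ b -ℤ + c +ℤ + e) *ℤ + f +ℤ + g ≡ (a + c * f + g) ⊖ (b * f + e * f)
affine-⊖ a b c e f g = begin
  + a -ℤ (+ b -ℤ + c +ℤ + e) *ℤ + f +ℤ + g
    ≡⟨ rearrange (+ a) (+ b) (+ c) (+ e) (+ f) (+ g) ⟩
  (+ a +ℤ + c *ℤ + f +ℤ + g) -ℤ (+ b *ℤ + f +ℤ + e *ℤ + f)
    ≡⟨ cong₂ _-ℤ_ (cong (λ t → + a +ℤ t +ℤ + g) (ℤ.pos-* c f)) (cong₂ _+ℤ_ (ℤ.pos-* b f) (ℤ.pos-* e f)) ⟨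
  (+ a +ℤ + (c * f) +ℤ + g) -ℤ (+ (b * f) +ℤ + (e * f))
    ≡⟨ cong₂ _-ℤ_ (trans (cong (_+ℤ + g) (ℤ.pos-+ a (c * f))) (ℤ.pos-+ (a + c * f) g)) (ℤ.pos-+ (b * f) (e * f)) ⟨
  + (a + c * f + g) -ℤ + (b * f + e * f)
    ≡⟨ ℤ.[+m]-[+n]≡m⊖n (a + c * f + g) (b * f + e * f) ⟩
  (a + c * f + g) ⊖ (b * f + e * f) ∎
  where
  open ≡-Reasoning
  rearrange : ∀ (A B C E F G : ℤ) → A -ℤ (B -ℤ C +ℤ E) *ℤ F +ℤ G ≡ (A +ℤ C *ℤ F +ℤ G) -ℤ (B *ℤ F +ℤ E *ℤ F)
  rearrange = ℤ.solve-∀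

9n≤5n²+4 : ∀ n → 9 * n ≤ 5 * (n * n) + 4
9n≤5n²+4 zero          = z≤n
9n≤5n²+4 (suc zero)    = ≤-refl
9n≤5n²+4 (suc (suc p)) = begin
  9 * suc (suc p)                                  ≤⟨ m≤m+n _ _ ⟩
  9 * suc (suc p) + (5 * (p * p) + 11 * p + 6)     ≡⟨ solve (p ∷ []) ⟩
  5 * (suc (suc p) * suc (suc p)) + 4              ∎
  where open ≤-Reasoning

^[2n∸2]≡[^[n∸1]]² : ∀ m n → m ^ (2 * n ∸ 2) ≡ m ^ (n ∸ 1) * m ^ (n ∸ 1)
^[2n∸2]≡[^[n∸1]]² m zero    = refl
^[2n∸2]≡[^[n∸1]]² m (suc n) = begin
  m ^ (2 * suc n ∸ 2)  ≡⟨ cong (λ t → m ^ (t ∸ 2)) (*-distribˡ-+ 2 1 n) ⟩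
  m ^ (n + (n + 0))    ≡⟨ cong (λ t → m ^ (n + t)) (+-identityʳ n) ⟩
  m ^ (n + n)          ≡⟨ ^-distribˡ-+-* m n n ⟩
  m ^ n * m ^ n        ∎
  where open ≡-Reasoning

r-lower-ℤ : ∀ {Q r} → 10 * Q ≤ 3 * r + 1 → + (10 * Q) -ℤ + 1 ≤ℤ + (3 * r)
r-lower-ℤ {Q} {r} 10Q≤3r+1 = subst (_≤ℤ + (3 * r)) (sym (ℤ.[+m]-[+n]≡m⊖n (10 * Q) 1))
  (⊖-mono-≤ {10 * Q} {1} {3 * r} {0} (subst (_≤ 3 * r + 1) (sym (+-identityʳ (10 * Q))) 10Q≤3r+1))

r-upper-ℤ : ∀ {D P Q r C c} → 0 < D → 0 < r →
  5 * Q + 4 ≤ 3 * C + 9 * P → D * C + (D ∸ 1) * (r ∸ 1) ≤ c →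
  + (3 * (D ∸ 1) * r) ≤ℤ + (3 * c) -ℤ (+ (5 * Q) -ℤ + (9 * P) +ℤ + 4) *ℤ + D +ℤ + (3 * (D ∸ 1))
r-upper-ℤ {D@(suc δ)} {P} {Q} {r@(suc ρ)} {C} {c} _ _ C-bound C≤c =
  subst (_ ≤ℤ_) (sym (affine-⊖ (3 * c) (5 * Q) (9 * P) 4 D (3 * δ)))
  (⊖-mono-≤ {3 * δ * r} {0} {3 * c + 9 * P * D + 3 * δ} {5 * Q * D + 4 * D} (begin
    3 * δ * r + (5 * Q * D + 4 * D)               ≡⟨ solve (δ ∷ ρ ∷ Q ∷ []) ⟩
    3 * δ * r + (5 * Q + 4) * D                   ≤⟨ +-monoʳ-≤ (3 * δ * r) (*-monoˡ-≤ D C-bound) ⟩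
    3 * δ * r + (3 * C + 9 * P) * D               ≡⟨ solve (δ ∷ ρ ∷ C ∷ P ∷ []) ⟩
    3 * (D * C + δ * ρ) + 9 * P * D + 3 * δ       ≤⟨ +-monoˡ-≤ (3 * δ) (+-monoˡ-≤ (9 * P * D) (*-monoʳ-≤ 3 C≤c)) ⟩
    3 * c + 9 * P * D + 3 * δ                     ≡⟨ +-identityʳ _ ⟨
    3 * c + 9 * P * D + 3 * δ + 0                 ∎))
  where open ≤-Reasoning

c-upper-ℤ : ∀ {D P Q c} → 2 ≤ D → 9 * P ≤ 5 * Q + 4 →
  + (3 * c) -ℤ (+ (5 * Q) -ℤ + (9 * P) +ℤ + 4) *ℤ + D +ℤ + (3 * (D ∸ 1))
    ≤ℤ + (3 * (D ∸ 1) * c) -ℤ (+ (5 * Q) -ℤ + (9 * P) +ℤ + 1) *ℤ + (D ∸ 1)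
c-upper-ℤ {D@(suc δ@(suc δ'))} {P} {Q} {c} (s≤s (s≤s z≤n)) 9P≤5Q+4 = subst₂ _≤ℤ_
  (sym (affine-⊖ (3 * c) (5 * Q) (9 * P) 4 D (3 * δ)))
  (trans (sym (affine-⊖ (3 * δ * c) (5 * Q) (9 * P) 1 δ 0)) (ℤ.+-identityʳ _))
  (⊖-mono-≤ {3 * c + 9 * P * D + 3 * δ} {5 * Q * D + 4 * D} {3 * δ * c + 9 * P * δ + 0} {5 * Q * δ + 1 * δ}
    (begin
      3 * c + 9 * P * D + 3 * δ + (5 * Q * δ + 1 * δ)              ≡⟨ solve (δ' ∷ c ∷ P ∷ Q ∷ []) ⟩
      3 * c + 9 * P + (9 * P * δ + 4 * δ + 5 * Q * δ)              ≤⟨ +-monoˡ-≤ _ (+-mono-≤ 3c≤3δc 9P≤5Q+4) ⟩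
      3 * (δ * c) + (5 * Q + 4) + (9 * P * δ + 4 * δ + 5 * Q * δ)  ≡⟨ solve (δ' ∷ c ∷ P ∷ Q ∷ []) ⟩
      3 * δ * c + 9 * P * δ + 0 + (5 * Q * D + 4 * D)              ∎))
  where
  open ≤-Reasoning
  3c≤3δc : 3 * c ≤ 3 * (δ * c)
  3c≤3δc = *-monoʳ-≤ 3 (m≤n*m c δ)

corollary5p3 : (h : ℕ) → 2 ≤ h → (r : Fin (suc h) → ℕ) →
  IsMinGenNumSG r → StrictlyIncreasing r → PlaneCurveSemigroup h r →
  (c : ℕ) → IsConductor r c →
  (1 < d r h)
  × (+ (10 * 2 ^ (2 * h ∸ 2)) -ℤ + 1 ≤ℤ + (3 * r (fromℕ h)))
  × (+ (3 * (d r h ∸ 1) * r (fromℕ h))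
      ≤ℤ + (3 * c) -ℤ (+ (5 * 2 ^ (2 * h ∸ 2)) -ℤ + (9 * 2 ^ (h ∸ 1)) +ℤ + 4) *ℤ + (d r h)
         +ℤ + (3 * (d r h ∸ 1)))
  × (+ (3 * c) -ℤ (+ (5 * 2 ^ (2 * h ∸ 2)) -ℤ + (9 * 2 ^ (h ∸ 1)) +ℤ + 4) *ℤ + (d r h)
         +ℤ + (3 * (d r h ∸ 1))
      ≤ℤ + (3 * (d r h ∸ 1) * c) -ℤ (+ (5 * 2 ^ (2 * h ∸ 2)) -ℤ + (9 * 2 ^ (h ∸ 1)) +ℤ + 1) *ℤ + (d r h ∸ 1))
-- The first two hypotheses are repeated inside PlaneCurveSemigroup.
corollary5p3 _ (s≤s (s≤s {n = k} z≤n)) u _ _ ((u↑ , free) , plane) c (≥c⇒∈ , _) =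
  D≥2 ,
  r-lower-ℤ {Q} {r} r-bound ,
  r-upper-ℤ {D} {P} {Q} {r} {C} (<-trans z<s D≥2) r>0 C-bound C≤c ,
  c-upper-ℤ {D} {P} {Q} {c} D≥2 9P≤5Q+4
  where
  open Gluing u free
  P Q : ℕ
  P = 2 ^ suc k
  Q = 2 ^ (2 * suc (suc k) ∸ 2)
  Q≡P² : Q ≡ P * P
  Q≡P² = ^[2n∸2]≡[^[n∸1]]² 2 (suc (suc k))
  r-bound : 10 * Q ≤ 3 * r + 1
  r-bound = subst (λ X → 10 * X ≤ 3 * r + 1) (sym Q≡P²) (last-lower-bound (suc k) u free u↑ plane)
  9P≤5Q+4 : 9 * P ≤ 5 * Q + 4
  9P≤5Q+4 = subst (λ X → 9 * P ≤ 5 * X + 4) (sym Q≡P²) (9n≤5n²+4 P)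
  conductor-bound : ∃[ C ] GapBelow s C × 5 * (P * P) + 4 ≤ 3 * C + 9 * P
  conductor-bound = conductor-lower-bound (suc k) s s-free (s-increasing u↑) (s-plane plane)
  C : ℕ
  C = proj₁ conductor-bound
  C-bound : 5 * Q + 4 ≤ 3 * C + 9 * P
  C-bound = subst (λ X → 5 * X + 4 ≤ 3 * C + 9 * P) (sym Q≡P²) (proj₂ (proj₂ conductor-bound))
  C≤c : D * C + (D ∸ 1) * (r ∸ 1) ≤ c
  C≤c = GapBelow⇒≤conductor {s = u} (gap-glued (proj₁ (proj₂ conductor-bound))) ≥c⇒∈
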